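{- Let $M$ be an algebraic $\lambda$-term. If there exists $s\in\mathcal T^*(M)$ such that $\mathrm{NF}(s)\neq0$, then $M$ is weakly solvable.
   Context: Resource terms $s::=x\mid\lambda x.s\mid\langle s\rangle\bar t$, monomials $\bar t=[t_1..t_n]$ finite multisets of resource terms, up to $\alpha$; finite formal sums with linearly extended constructors; multilinear substitution $e\langle\bar u/x\rangle=\sum_f e[u_1/x_{f(1)},\dots,u_n/x_{f(n)}]$ over bijections $f$ from $\{1..n\}$ to the free occurrences of $x$ in $e$ ($0$ if counts differ). Resource reduction $\to_r$: contextual closure of $\langle\lambda x.s\rangle\bar t\to_r s\langle\bar t/x\rangle$; $\mathrm{NF}(s)$ is the unique normal form of $s$ (a finite sum of resource terms without such redexes). $\mathcal S$ is a commutative semiring. Algebraic $\lambda$-terms $M::=x\mid\lambda x.M\mid(M)N\mid0\mid a\cdot M\mid M+N$ up to $\alpha$ and the congruence generated by $\lambda x.0=0$, $\lambda x.(a\cdot M)=a\cdot\lambda x.M$, $\lambda x.(M+N)=\lambda x.M+\lambda x.N$, $(0)P=0$, $(a\cdot M)P=a\cdot(M)P$, $(M+N)P=(M)P+(N)P$; canonical forms $M::=S\mid0\mid a\cdot M\mid M+N$, $S::=x\mid\lambda x.S\mid(S)M$. Taylor support $\mathcal T^*$: $\{x\}$; $\{\lambda x.s:s\in\mathcal T^*(M)\}$; $\{\langle s\rangle[t_1..t_n]:s\in\mathcal T^*(M),n\ge0,t_i\in\mathcal T^*(N)\}$ for $(M)N$; $\emptyset$; $\mathcal T^*(M)$ for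 $a\cdot M$; $\mathcal T^*(M)\cup\mathcal T^*(N)$. Weak solvability $\mathrm{ws}(M)$ is derived by: $\mathrm{ws}((x)M_1\cdots M_n)$; $\mathrm{ws}(S)\Rightarrow\mathrm{ws}(\lambda x.S)$; $\mathrm{ws}((S[M_0/x])M_1\cdots M_n)\Rightarrow\mathrm{ws}((\lambda x.S)M_0M_1\cdots M_n)$ (capture-avoiding substitution); $\mathrm{ws}(M)\Rightarrow\mathrm{ws}(a\cdot M)$; $\mathrm{ws}(M)\Rightarrow\mathrm{ws}(M+N)$; $\mathrm{ws}(N)\Rightarrow\mathrm{ws}(M+N)$. -}

module Defs where

open import Level using (Level)
open import Data.Nat using (ℕ; zero; suc; _<ᵇ_; _≡ᵇ_; pred)
open import Data.Bool using (if_then_else_)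
open import Data.List using (List; []; _∷_; _++_; map; concatMap; foldl)
open import Data.List.Relation.Unary.All using (All)
open import Data.Unit using (⊤)
open import Data.Empty using (⊥)
open import Data.Product using (_×_; _,_)
open import Relation.Binary.Construct.Closure.ReflexiveTransitive using (Star)

-- Resource terms (de Bruijn indices, so α-equivalence is syntactic
-- equality).  A monomial [t1..tn] is represented by a list; finite
-- formal sums of resource terms (natural-number coefficients) are
-- represented by lists of resource terms; the empty list is the sum 0.

data RTerm : Set where
  var : ℕ → RTerm
  lam : RTerm → RTerm
  app : RTerm → List RTerm → RTerm

RSum : Set
RSum = List RTerm

ext : (ℕ → ℕ) → ℕ → ℕ
ext ρ zero    = zero
ext ρ (suc n) = suc (ρ n)

mutual
  rename : (ℕ → ℕ) → RTerm → RTerm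
  rename ρ (var n)    = var (ρ n)
  rename ρ (lam s)    = lam (rename (ext ρ) s)
  rename ρ (app s ts) = app (rename ρ s) (renames ρ ts)

  renames : (ℕ → ℕ) → List RTerm → List RTerm
  renames ρ []       = []
  renames ρ (t ∷ ts) = rename ρ t ∷ renames ρ ts

splits : {A : Set} → List A → List (List A × List A)
splits []       = ([] , []) ∷ []
splits (a ∷ as) =
  concatMap (λ { (l , r) → (a ∷ l , r) ∷ (l , a ∷ r) ∷ [] }) (splits as)

-- Multilinear substitution  e⟨ū/x⟩  where x is the de Bruijn index k:
-- the sum, over all bijections from the elements of ū to the free
-- occurrences of x, of the corresponding substitution (0 if counts differ).
-- Free indices above k are decremented (x disappears).
mutual
  msub : ℕ → RTerm → List RTerm → RSum
  msub k (var n) us with n ≡ᵇ k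
  msub k (var n) (u ∷ [])     | Data.Bool.true = u ∷ []
  msub k (var n) _            | Data.Bool.true = []
  msub k (var n) []           | Data.Bool.false =
    (if n <ᵇ k then var n else var (pred n)) ∷ []
  msub k (var n) (_ ∷ _)      | Data.Bool.false = []
  msub k (lam s) us = map lam (msub (suc k) s (renames suc us))
  msub k (app s ts) us =
    concatMap (λ { (l , r) →
      concatMap (λ s' → map (app s') (msubBag k ts r)) (msub k s l) })
      (splits us)

  msubBag : ℕ → List RTerm → List RTerm → List (List RTerm)
  msubBag k []       []      = [] ∷ []
  msubBag k []       (_ ∷ _) = []
  msubBag k (t ∷ ts) us =
    concatMap (λ { (l , r) →
      concatMap (λ t' → map (t' ∷_) (msubBag k ts r)) (msub k t l) })
      (splits us)

data _→r_ : RTerm → RSum → Set where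
  β   : ∀ {s ts} → app (lam s) ts →r msub zero s ts
  ξλ  : ∀ {s T} → s →r T → lam s →r map lam T
  ξl  : ∀ {s ts T} → s →r T → app s ts →r map (λ s' → app s' ts) T
  ξr  : ∀ {s us t vs T} → t →r T →
        app s (us ++ t ∷ vs) →r map (λ t' → app s (us ++ t' ∷ vs)) T

data _⇒r_ : RSum → RSum → Set where
  step : ∀ {A s B T} → s →r T → (A ++ s ∷ B) ⇒r (A ++ T ++ B)

_⇒r*_ : RSum → RSum → Set
_⇒r*_ = Star _⇒r_

NotLam : RTerm → Set
NotLam (lam _) = ⊥
NotLam _       = ⊤

data Normal : RTerm → Set where
  var : ∀ {n} → Normal (var n)
  lam : ∀ {s} → Normal s → Normal (lam s)
  app : ∀ {s ts} → NotLam s → Normal s → All Normal ts → Normal (app s ts)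

IsNF : RTerm → RSum → Set
IsNF s S = ((s ∷ []) ⇒r* S) × All Normal S

-- Algebraic λ-terms over scalars A, in canonical form (these are
-- representatives of the quotient by the linearity congruence).
--   M ::= S | 0 | a·M | M+N      S ::= x | λx.S | (S)M

module _ {c : Level} (A : Set c) where
  mutual
    data Simple : Set c where
      var : ℕ → Simple
      lam : Simple → Simple
      app : Simple → Canon → Simple

    data Canon : Set c where
      simp : Simple → Canon
      zer  : Canon
      scal : A → Canon → Canon
      plus : Canon → Canon → Canon

module _ {c : Level} {A : Set c} where

  lamC : Canon A → Canon A
  lamC (simp S)   = simp (lam S)
  lamC zer        = zer
  lamC (scal a M) = scal a (lamC M)
  lamC (plus M N) = plus (lamC M) (lamC N)

  appC : Canon A → Canon A → Canon A
  appC (simp S)   P = simp (app S P)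
  appC zer        P = zer
  appC (scal a M) P = scal a (appC M P)
  appC (plus M N) P = plus (appC M P) (appC N P)

  appsC : Canon A → List (Canon A) → Canon A
  appsC = foldl appC

  appsS : Simple A → List (Canon A) → Simple A
  appsS = foldl app

  mutual
    renS : (ℕ → ℕ) → Simple A → Simple A
    renS ρ (var n)   = var (ρ n)
    renS ρ (lam S)   = lam (renS (ext ρ) S)
    renS ρ (app S M) = app (renS ρ S) (renC ρ M)

    renC : (ℕ → ℕ) → Canon A → Canon A
    renC ρ (simp S)   = simp (renS ρ S)
    renC ρ zer        = zer
    renC ρ (scal a M) = scal a (renC ρ M)
    renC ρ (plus M N) = plus (renC ρ M) (renC ρ N)

  extsC : (ℕ → Canon A) → ℕ → Canon A
  extsC σ zero    = simp (var zero)
  extsC σ (suc n) = renC suc (σ n)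

  mutual
    subS : (ℕ → Canon A) → Simple A → Canon A
    subS σ (var n)   = σ n
    subS σ (lam S)   = lamC (subS (extsC σ) S)
    subS σ (app S M) = appC (subS σ S) (subC σ M)

    subC : (ℕ → Canon A) → Canon A → Canon A
    subC σ (simp S)   = subS σ S
    subC σ zer        = zer
    subC σ (scal a M) = scal a (subC σ M)
    subC σ (plus M N) = plus (subC σ M) (subC σ N)

  sub0 : Canon A → ℕ → Canon A
  sub0 M zero    = M
  sub0 M (suc n) = simp (var n)

  data WS : Canon A → Set c where
    ws-head : ∀ x Ms → WS (simp (appsS (var x) Ms))
    ws-lam  : ∀ {S} → WS (simp S) → WS (simp (lam S))
    ws-β    : ∀ {S M0 Ms} → WS (appsC (subS (sub0 M0) S) Ms) →
              WS (simp (appsS (lam S) (M0 ∷ Ms)))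
    ws-scal : ∀ {a M} → WS M → WS (scal a M)
    ws-plusˡ : ∀ {M N} → WS M → WS (plus M N)
    ws-plusʳ : ∀ {M N} → WS N → WS (plus M N)

  -- Taylor support: TS S s  means  s ∈ T*(S)
  mutual
    data TS : Simple A → RTerm → Set c where
      var : ∀ {x} → TS (var x) (var x)
      lam : ∀ {S s} → TS S s → TS (lam S) (lam s)
      app : ∀ {S N s ts} → TS S s → All (TC N) ts → TS (app S N) (app s ts)

    data TC : Canon A → RTerm → Set c where
      simp  : ∀ {S s} → TS S s → TC (simp S) s
      scal  : ∀ {a M s} → TC M s → TC (scal a M) s
      plusˡ : ∀ {M N s} → TC M s → TC (plus M N) s
      plusʳ : ∀ {M N s} → TC N s → TC (plus M N) s

-- RWS, the resource analogue of weak solvability (same rules, the β-rule choosing one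
-- summand of the multilinear substitution), holds for resource normal forms and is
-- reflected by resource reduction: if a summand of a reduct of s is RWS, so is s.
-- Reflection rests on the substitution lemma (a⟨b̄/x⟩)⟨v̄/y⟩ = Σ (a⟨v̄₁/y⟩)⟨b̄⟨v̄₂/y⟩/x⟩,
-- the sum ranging over the splittings v̄ = v̄₁ · v̄₂. So NF(s) ≠ 0 makes s RWS, and an
-- RWS derivation for s ∈ T*(M) is replayed rule by rule on M, because Taylor supports
-- are stable under the substitutions performed by the β-rule.
module Submission where

open import Defs
open import Algebra.Bundles using (CommutativeSemiring)
open import Data.Nat using (ℕ; zero; suc; _<ᵇ_; _≡ᵇ_; pred; _<_; _≤_; z≤n; s≤s; _≟_)
open import Data.Nat.Properties using (≡ᵇ⇒≡; ≡⇒≡ᵇ; <⇒<ᵇ; <ᵇ⇒<; <-cmp; ≤-trans; <-≤-trans; ≤-<-trans; <⇒≱; <⇒≤; <-irrefl; n≤1+n)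
open import Data.Bool using (true; false; if_then_else_; T)
open import Data.List using (List; []; _∷_; _++_; map)
open import Data.List.Membership.Propositional using (_∈_; find; lose)
open import Data.List.Membership.Propositional.Properties using (∈-map⁺; ∈-map⁻; ∈-concatMap⁺; ∈-concatMap⁻; ∈-++⁻; ∈-++⁺ˡ; ∈-++⁺ʳ)
open import Data.List.Relation.Unary.Any using (here; there)
open import Data.List.Relation.Unary.All using (All; _∷_; [])
open import Data.List.Relation.Binary.Pointwise using (Pointwise; []; _∷_)
open import Data.List.Relation.Ternary.Interleaving.Propositional {A = RTerm} using (Interleaving; []; consˡ; consʳ; swap)
open import Data.Product using (∃; ∃₂; _×_; _,_; Σ; proj₁; proj₂)
open import Data.Sum using (_⊎_; inj₁; inj₂)
open import Data.Empty using (⊥-elim)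
open import Data.Unit using (tt)
open import Relation.Binary.PropositionalEquality using (_≡_; _≢_; refl; sym; trans; cong; cong₂; subst; subst₂)
open import Relation.Nullary using (yes; no)
open import Relation.Binary using (tri<; tri≈; tri>)
open import Relation.Binary.Construct.Closure.ReflexiveTransitive using (ε; _◅_)
open import Level using (Level)

-- Interleavings

∈-splits⁻ : ∀ xs {l r} → (l , r) ∈ splits xs → Interleaving l r xs
∈-splits⁻ []       (here refl) = []
∈-splits⁻ (x ∷ xs) m with find (∈-concatMap⁻ _ {xs = splits xs} m)
... | _ , p , here refl         = consˡ (∈-splits⁻ xs p)
... | _ , p , there (here refl) = consʳ (∈-splits⁻ xs p)

∈-splits⁺ : ∀ {xs l r} → Interleaving l r xs → (l , r) ∈ splits xs
∈-splits⁺ []                = here refl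
∈-splits⁺ {_ ∷ xs} (consˡ i) = ∈-concatMap⁺ _ {xs = splits xs} (lose (∈-splits⁺ i) (here refl))
∈-splits⁺ {_ ∷ xs} (consʳ i) = ∈-concatMap⁺ _ {xs = splits xs} (lose (∈-splits⁺ i) (there (here refl)))

interleaving-[] : ∀ {xs} → Interleaving [] [] xs → xs ≡ []
interleaving-[] [] = refl

allˡ : ∀ xs → Interleaving xs [] xs
allˡ []       = []
allˡ (x ∷ xs) = consˡ (allˡ xs)

allʳ : ∀ xs → Interleaving [] xs xs
allʳ []       = []
allʳ (x ∷ xs) = consʳ (allʳ xs)

-- Writing xs = l ⋈ r for Interleaving l r xs, the regroupings are instances of the
-- associativity and commutativity of ⋈, and interchange is its medial law.
regroupˡ : ∀ {xs l r l₁ l₂} → Interleaving l r xs → Interleaving l₁ l₂ l →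
           ∃ λ m → Interleaving l₁ m xs × Interleaving l₂ r m
regroupˡ [] [] = [] , [] , []
regroupˡ (consˡ i) (consˡ j) with regroupˡ i j
... | m , a , b = m , consˡ a , b
regroupˡ (consˡ i) (consʳ j) with regroupˡ i j
... | m , a , b = _ , consʳ a , consˡ b
regroupˡ (consʳ i) j with regroupˡ i j
... | m , a , b = _ , consʳ a , consʳ b

regroupʳ : ∀ {xs l r r₁ r₂} → Interleaving l r xs → Interleaving r₁ r₂ r →
           ∃ λ m → Interleaving r₁ m xs × Interleaving l r₂ m
regroupʳ i j with regroupˡ (swap i) j
... | m , a , b = m , a , swap b

regroup⁻ : ∀ {xs l r r₁ r₂} → Interleaving l r xs → Interleaving r₁ r₂ r →
           ∃ λ m → Interleaving m r₂ xs × Interleaving l r₁ m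
regroup⁻ [] [] = [] , [] , []
regroup⁻ (consˡ i) j with regroup⁻ i j
... | m , a , b = _ , consˡ a , consˡ b
regroup⁻ (consʳ i) (consˡ j) with regroup⁻ i j
... | m , a , b = _ , consˡ a , consʳ b
regroup⁻ (consʳ i) (consʳ j) with regroup⁻ i j
... | m , a , b = m , consʳ a , b

interchange : ∀ {xs l r a b c d} → Interleaving l r xs → Interleaving a b l → Interleaving c d r →
              ∃₂ λ p q → Interleaving p q xs × Interleaving a c p × Interleaving b d q
interchange i j k with regroupˡ i j
... | m , i₁ , i₂ with regroupʳ i₂ k
... | q , i₃ , i₄ with regroup⁻ i₁ i₃
... | p , i₅ , i₆ = p , q , i₅ , i₆ , i₄

-- Multilinear substitution

punchOut : ℕ → ℕ → ℕ
punchOut k n = if n <ᵇ k then n else pred n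

-- MSub k u vs w : w is one of the summands of u⟨vs/k⟩
mutual
  data MSub : ℕ → RTerm → List RTerm → RTerm → Set where
    hit  : ∀ {k v} → MSub k (var k) (v ∷ []) v
    miss : ∀ {k n} → n ≢ k → MSub k (var n) [] (var (punchOut k n))
    lam  : ∀ {k u vs w} → MSub (suc k) u (renames suc vs) w → MSub k (lam u) vs (lam w)
    app  : ∀ {k s ts vs l r s′ ts′} → Interleaving l r vs →
           MSub k s l s′ → MSubs k ts r ts′ → MSub k (app s ts) vs (app s′ ts′)

  data MSubs : ℕ → List RTerm → List RTerm → List RTerm → Set where
    []   : ∀ {k} → MSubs k [] [] []
    cons : ∀ {k t ts vs l r t′ ts′} → Interleaving l r vs →
           MSub k t l t′ → MSubs k ts r ts′ → MSubs k (t ∷ ts) vs (t′ ∷ ts′)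

if-var : ∀ b n → (if b then RTerm.var n else var (pred n)) ≡ RTerm.var (if b then n else pred n)
if-var true  n = refl
if-var false n = refl

mutual
  ∈-msub⁻ : ∀ k u vs {w} → w ∈ msub k u vs → MSub k u vs w
  ∈-msub⁻ k (var n) vs m with n ≡ᵇ k in eq
  ∈-msub⁻ k (var n) (v ∷ []) (here refl) | true with ≡ᵇ⇒≡ n k (subst T (sym eq) tt)
  ... | refl = hit
  ∈-msub⁻ k (var n) [] (here refl) | false =
    subst (MSub k (var n) []) (sym (if-var (n <ᵇ k) n))
          (miss λ n≡k → subst T eq (≡⇒≡ᵇ n k n≡k))
  ∈-msub⁻ k (lam u) vs m with ∈-map⁻ lam m
  ... | w , m′ , refl = lam (∈-msub⁻ (suc k) u (renames suc vs) m′)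
  ∈-msub⁻ k (app s ts) vs m with find (∈-concatMap⁻ _ {xs = splits vs} m)
  ... | (l , r) , p , m₂ with find (∈-concatMap⁻ _ {xs = msub k s l} m₂)
  ... | s′ , m₃ , m₄ with ∈-map⁻ (app s′) m₄
  ... | ts′ , m₅ , refl = app (∈-splits⁻ vs p) (∈-msub⁻ k s l m₃) (∈-msubBag⁻ k ts r m₅)

  ∈-msubBag⁻ : ∀ k ts vs {ws} → ws ∈ msubBag k ts vs → MSubs k ts vs ws
  ∈-msubBag⁻ k [] [] (here refl) = []
  ∈-msubBag⁻ k (t ∷ ts) vs m with find (∈-concatMap⁻ _ {xs = splits vs} m)
  ... | (l , r) , p , m₂ with find (∈-concatMap⁻ _ {xs = msub k t l} m₂)
  ... | t′ , m₃ , m₄ with ∈-map⁻ (t′ ∷_) m₄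
  ... | ts′ , m₅ , refl = cons (∈-splits⁻ vs p) (∈-msub⁻ k t l m₃) (∈-msubBag⁻ k ts r m₅)

mutual
  ∈-msub⁺ : ∀ {k u vs w} → MSub k u vs w → w ∈ msub k u vs
  ∈-msub⁺ {k} hit with k ≡ᵇ k in eq
  ... | true  = here refl
  ... | false = ⊥-elim (subst T eq (≡⇒≡ᵇ k k refl))
  ∈-msub⁺ {k} (miss {n = n} n≢k) with n ≡ᵇ k in eq
  ... | true  = ⊥-elim (n≢k (≡ᵇ⇒≡ n k (subst T (sym eq) tt)))
  ... | false = here (sym (if-var (n <ᵇ k) n))
  ∈-msub⁺ (lam σ) = ∈-map⁺ lam (∈-msub⁺ σ)
  ∈-msub⁺ {k} {app s ts} {vs} (app {l = l} {s′ = s′} i σ σs) =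
    ∈-concatMap⁺ _ {xs = splits vs} (lose (∈-splits⁺ i)
      (∈-concatMap⁺ _ {xs = msub k s l} (lose (∈-msub⁺ σ) (∈-map⁺ (app s′) (∈-msubBag⁺ σs)))))

  ∈-msubBag⁺ : ∀ {k ts vs ws} → MSubs k ts vs ws → ws ∈ msubBag k ts vs
  ∈-msubBag⁺ [] = here refl
  ∈-msubBag⁺ {k} {t ∷ ts} {vs} (cons {l = l} {t′ = t′} i σ σs) =
    ∈-concatMap⁺ _ {xs = splits vs} (lose (∈-splits⁺ i)
      (∈-concatMap⁺ _ {xs = msub k t l} (lose (∈-msub⁺ σ) (∈-map⁺ (t′ ∷_) (∈-msubBag⁺ σs)))))

suc-≢ : ∀ {m n} → m ≢ n → suc m ≢ suc n
suc-≢ m≢n refl = m≢n refl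

punchOut-< : ∀ {k n} → n < k → punchOut k n ≡ n
punchOut-< {k} {n} n<k with n <ᵇ k in eq
... | true  = refl
... | false = ⊥-elim (subst T eq (<⇒<ᵇ n<k))

punchOut-> : ∀ {k n} → k < n → punchOut k n ≡ pred n
punchOut-> {k} {n} k<n with n <ᵇ k in eq
... | true  = ⊥-elim (<⇒≱ k<n (<⇒≤ (<ᵇ⇒< n k (subst T (sym eq) tt))))
... | false = refl

punchOut-suc : ∀ k n → n ≢ k → punchOut (suc k) (suc n) ≡ suc (punchOut k n)
punchOut-suc zero    zero    n≢k = ⊥-elim (n≢k refl)
punchOut-suc (suc k) zero    n≢k = refl
punchOut-suc k       (suc n) n≢k with suc n <ᵇ k
... | true  = refl
... | false = refl

punchOut-hit : ∀ {i k n} → i ≤ k → n ≢ i → punchOut i n ≡ k → n ≡ suc k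
punchOut-hit {i} {k} {n} i≤k n≢i eq with <-cmp n i
... | tri< n<i _ _ = ⊥-elim (<⇒≱ n<i (subst (i ≤_) (trans (sym eq) (punchOut-< n<i)) i≤k))
... | tri≈ _ n≡i _ = ⊥-elim (n≢i n≡i)
punchOut-hit {n = suc m} i≤k n≢i eq | tri> _ _ i<n = cong suc (trans (sym (punchOut-> i<n)) eq)

punchOut-miss : ∀ {i k n} → i ≤ k → n ≢ i → n ≢ suc k → punchOut (suc k) n ≢ i
punchOut-miss {i} {k} {n} i≤k n≢i n≢sk with <-cmp n (suc k)
... | tri< n<sk _ _ = subst (_≢ i) (sym (punchOut-< n<sk)) n≢i
... | tri≈ _ n≡sk _ = ⊥-elim (n≢sk n≡sk)
punchOut-miss {i} {k} {suc m} i≤k n≢i n≢sk | tri> _ _ (s≤s k<m) =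
  subst (_≢ i) (sym (punchOut-> (s≤s k<m))) λ m≡i → <-irrefl (sym m≡i) (≤-<-trans i≤k k<m)

punchOut-comm : ∀ {i k n} → i ≤ k → n ≢ i → n ≢ suc k →
                punchOut i (punchOut (suc k) n) ≡ punchOut k (punchOut i n)
punchOut-comm {i} {k} {n} i≤k n≢i n≢sk with <-cmp n i
... | tri< n<i _ _ =
  let n<k = <-≤-trans n<i i≤k in
  trans (cong (punchOut i) (punchOut-< (≤-trans n<k (n≤1+n k))))
        (trans (punchOut-< n<i) (sym (trans (cong (punchOut k) (punchOut-< n<i)) (punchOut-< n<k))))
... | tri≈ _ n≡i _ = ⊥-elim (n≢i n≡i)
punchOut-comm {i} {k} {suc m} i≤k n≢i n≢sk | tri> _ _ i<n with <-cmp (suc m) (suc k)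
... | tri< (s≤s m<k) _ _ =
  trans (cong (punchOut i) (punchOut-< (s≤s m<k)))
        (trans (punchOut-> i<n) (sym (trans (cong (punchOut k) (punchOut-> i<n)) (punchOut-< m<k))))
... | tri≈ _ n≡sk _ = ⊥-elim (n≢sk n≡sk)
... | tri> _ _ (s≤s k<m) =
  trans (cong (punchOut i) (punchOut-> (s≤s k<m)))
        (trans (punchOut-> (≤-<-trans i≤k k<m)) (sym (trans (cong (punchOut k) (punchOut-> i<n)) (punchOut-> k<m))))

punchIn : ℕ → ℕ → ℕ
punchIn zero    = suc
punchIn (suc i) = ext (punchIn i)

punchIn-≢ : ∀ i m → punchIn i m ≢ i
punchIn-≢ zero    m       ()
punchIn-≢ (suc i) zero    ()
punchIn-≢ (suc i) (suc m) = suc-≢ (punchIn-≢ i m)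

punchOut-punchIn : ∀ i m → punchOut i (punchIn i m) ≡ m
punchOut-punchIn zero    m       = refl
punchOut-punchIn (suc i) zero    = refl
punchOut-punchIn (suc i) (suc m) =
  trans (punchOut-suc i (punchIn i m) (punchIn-≢ i m)) (cong suc (punchOut-punchIn i m))

mutual
  rename-∘ : ∀ {f g h} → (∀ n → f (g n) ≡ h n) → ∀ t → rename f (rename g t) ≡ rename h t
  rename-∘ e (var n)    = cong var (e n)
  rename-∘ e (lam t)    = cong lam (rename-∘ (ext-∘ e) t)
    where
      ext-∘ : ∀ {f g h} → (∀ n → f (g n) ≡ h n) → ∀ n → ext f (ext g n) ≡ ext h n
      ext-∘ e zero    = refl
      ext-∘ e (suc n) = cong suc (e n)
  rename-∘ e (app s ts) = cong₂ app (rename-∘ e s) (renames-∘ e ts)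

  renames-∘ : ∀ {f g h} → (∀ n → f (g n) ≡ h n) → ∀ ts → renames f (renames g ts) ≡ renames h ts
  renames-∘ e []       = refl
  renames-∘ e (t ∷ ts) = cong₂ _∷_ (rename-∘ e t) (renames-∘ e ts)

renames-ext-suc : ∀ ρ vs → renames (ext ρ) (renames suc vs) ≡ renames suc (renames ρ vs)
renames-ext-suc ρ vs = trans (renames-∘ (λ n → refl) vs) (sym (renames-∘ (λ n → refl) vs))

renames-++ : ∀ f xs ys → renames f (xs ++ ys) ≡ renames f xs ++ renames f ys
renames-++ f []       ys = refl
renames-++ f (x ∷ xs) ys = cong (rename f x ∷_) (renames-++ f xs ys)

renames-≡[] : ∀ {f} vs → renames f vs ≡ [] → vs ≡ []
renames-≡[] [] _ = refl

renames-≡[_] : ∀ {f} vs {v} → renames f vs ≡ v ∷ [] → ∃ λ v₀ → vs ≡ v₀ ∷ [] × v ≡ rename f v₀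
renames-≡[ x ∷ [] ] refl = x , refl , refl

interleaving-renames⁺ : ∀ {f vs l r} → Interleaving l r vs →
                        Interleaving (renames f l) (renames f r) (renames f vs)
interleaving-renames⁺ []        = []
interleaving-renames⁺ (consˡ i) = consˡ (interleaving-renames⁺ i)
interleaving-renames⁺ (consʳ i) = consʳ (interleaving-renames⁺ i)

interleaving-renames⁻ : ∀ {f} vs {l r} → Interleaving l r (renames f vs) →
                        ∃₂ λ l₀ r₀ → l ≡ renames f l₀ × r ≡ renames f r₀ × Interleaving l₀ r₀ vs
interleaving-renames⁻ []       []        = [] , [] , refl , refl , []
interleaving-renames⁻ (v ∷ vs) (consˡ i) with interleaving-renames⁻ vs i
... | l₀ , r₀ , refl , refl , i′ = v ∷ l₀ , r₀ , refl , refl , consˡ i′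
interleaving-renames⁻ (v ∷ vs) (consʳ i) with interleaving-renames⁻ vs i
... | l₀ , r₀ , refl , refl , i′ = l₀ , v ∷ r₀ , refl , refl , consʳ i′

Compatible : (ℕ → ℕ) → ℕ → (ℕ → ℕ) → Set
Compatible ρ k ρ′ = ∀ n → n ≢ k → (ρ n ≢ ρ k) × (punchOut (ρ k) (ρ n) ≡ ρ′ (punchOut k n))

Compatible-ext : ∀ {ρ k ρ′} → Compatible ρ k ρ′ → Compatible (ext ρ) (suc k) (ext ρ′)
Compatible-ext c zero    _   = (λ ()) , refl
Compatible-ext {ρ} {k} {ρ′} c (suc m) sm≢sk with c m (λ m≡k → sm≢sk (cong suc m≡k))
... | ρm≢ρk , eq = suc-≢ ρm≢ρk ,
  trans (punchOut-suc (ρ k) (ρ m) ρm≢ρk)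
        (trans (cong suc eq) (sym (cong (ext ρ′) (punchOut-suc k m λ m≡k → sm≢sk (cong suc m≡k)))))

Compatible-ext-0 : ∀ ρ → Compatible (ext ρ) 0 ρ
Compatible-ext-0 ρ zero    0≢0 = ⊥-elim (0≢0 refl)
Compatible-ext-0 ρ (suc m) _   = (λ ()) , refl

Compatible-suc : ∀ k → Compatible suc k suc
Compatible-suc k n n≢k = suc-≢ n≢k , punchOut-suc k n n≢k

mutual
  MSub-rename : ∀ {ρ k ρ′ u vs w} → Compatible ρ k ρ′ → MSub k u vs w →
                MSub (ρ k) (rename ρ u) (renames ρ′ vs) (rename ρ′ w)
  MSub-rename c hit = hit
  MSub-rename {ρ} {k} c (miss {n = n} n≢k) =
    subst (λ x → MSub (ρ k) (var (ρ n)) [] (var x)) (proj₂ (c n n≢k)) (miss (proj₁ (c n n≢k)))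
  MSub-rename {ρ} {k} {ρ′} {vs = vs} c (lam σ) =
    lam (subst (λ x → MSub (suc (ρ k)) _ x _) (renames-ext-suc ρ′ vs) (MSub-rename (Compatible-ext c) σ))
  MSub-rename c (app i σ σs) = app (interleaving-renames⁺ i) (MSub-rename c σ) (MSubs-rename c σs)

  MSubs-rename : ∀ {ρ k ρ′ ts vs ws} → Compatible ρ k ρ′ → MSubs k ts vs ws →
                 MSubs (ρ k) (renames ρ ts) (renames ρ′ vs) (renames ρ′ ws)
  MSubs-rename c []            = []
  MSubs-rename c (cons i σ σs) = cons (interleaving-renames⁺ i) (MSub-rename c σ) (MSubs-rename c σs)

MSub-var⁻ : ∀ {k m vs w} → MSub k (var m) vs w →
            (m ≡ k × ∃ λ v → vs ≡ v ∷ [] × w ≡ v) ⊎ (m ≢ k × vs ≡ [] × w ≡ var (punchOut k m))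
MSub-var⁻ hit        = inj₁ (refl , _ , refl , refl)
MSub-var⁻ (miss m≢k) = inj₂ (m≢k , refl , refl)

mutual
  MSub-rename⁻ : ∀ {ρ k ρ′} u vs {w′} → Compatible ρ k ρ′ →
                 MSub (ρ k) (rename ρ u) (renames ρ′ vs) w′ → ∃ λ w → w′ ≡ rename ρ′ w × MSub k u vs w
  MSub-rename⁻ {k = k} (var n) vs c σ with MSub-var⁻ σ | n ≟ k
  ... | inj₁ (_ , v , eq , refl) | yes refl with renames-≡[ vs ] eq
  ...   | v₀ , refl , refl = v₀ , refl , hit
  MSub-rename⁻ (var n) vs c σ | inj₁ (ρn≡ρk , _) | no n≢k = ⊥-elim (proj₁ (c n n≢k) ρn≡ρk)
  MSub-rename⁻ (var n) vs c σ | inj₂ (ρk≢ρk , _) | yes refl = ⊥-elim (ρk≢ρk refl)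
  MSub-rename⁻ {k = k} (var n) vs c σ | inj₂ (_ , eq , refl) | no n≢k with renames-≡[] vs eq
  ... | refl = var (punchOut k n) , cong var (proj₂ (c n n≢k)) , miss n≢k
  MSub-rename⁻ {ρ} {k} {ρ′} (lam u) vs c (lam σ)
    with MSub-rename⁻ u (renames suc vs) (Compatible-ext c)
           (subst (λ x → MSub (suc (ρ k)) _ x _) (sym (renames-ext-suc ρ′ vs)) σ)
  ... | w , refl , σ′ = lam w , refl , lam σ′
  MSub-rename⁻ (app u ts) vs c (app i σ σs) with interleaving-renames⁻ vs i
  ... | l₀ , r₀ , refl , refl , i′ with MSub-rename⁻ u l₀ c σ | MSubs-rename⁻ ts r₀ c σs
  ... | w , refl , σ′ | ws , refl , σs′ = app w ws , refl , app i′ σ′ σs′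

  MSubs-rename⁻ : ∀ {ρ k ρ′} ts vs {ws′} → Compatible ρ k ρ′ →
                  MSubs (ρ k) (renames ρ ts) (renames ρ′ vs) ws′ → ∃ λ ws → ws′ ≡ renames ρ′ ws × MSubs k ts vs ws
  MSubs-rename⁻ []       []       c []  = [] , refl , []
  MSubs-rename⁻ (t ∷ ts) vs c (cons i σ σs) with interleaving-renames⁻ vs i
  ... | l₀ , r₀ , refl , refl , i′ with MSub-rename⁻ t l₀ c σ | MSubs-rename⁻ ts r₀ c σs
  ... | w , refl , σ′ | ws , refl , σs′ = w ∷ ws , refl , cons i′ σ′ σs′

-- The substitution lemma

mutual
  MSub-punchIn : ∀ i v → MSub i (rename (punchIn i) v) [] v
  MSub-punchIn i (var m) =
    subst (λ x → MSub i (var (punchIn i m)) [] (var x)) (punchOut-punchIn i m) (miss (punchIn-≢ i m))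
  MSub-punchIn i (lam v)    = lam (MSub-punchIn (suc i) v)
  MSub-punchIn i (app v ts) = app [] (MSub-punchIn i v) (MSubs-punchIn i ts)

  MSubs-punchIn : ∀ i ts → MSubs i (renames (punchIn i) ts) [] ts
  MSubs-punchIn i []       = []
  MSubs-punchIn i (t ∷ ts) = cons [] (MSub-punchIn i t) (MSubs-punchIn i ts)

MSubs-interleaving : ∀ {k bs bs₁ bs₂ vs₁ vs₂ ws₁ ws₂ vs} → Interleaving bs₁ bs₂ bs →
                     MSubs k bs₁ vs₁ ws₁ → MSubs k bs₂ vs₂ ws₂ → Interleaving vs₁ vs₂ vs →
                     ∃ λ ws → MSubs k bs vs ws × Interleaving ws₁ ws₂ ws
MSubs-interleaving [] [] [] i with interleaving-[] i
... | refl = [] , [] , []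
MSubs-interleaving (consˡ b) (cons j σ σs) σs₂ i with regroupˡ i j
... | _ , i₁ , i₂ with MSubs-interleaving b σs σs₂ i₂
... | _ , σs′ , i′ = _ , cons i₁ σ σs′ , consˡ i′
MSubs-interleaving (consʳ b) σs₁ (cons j σ σs) i with regroupʳ i j
... | _ , i₁ , i₂ with MSubs-interleaving b σs₁ σs i₂
... | _ , σs′ , i′ = _ , cons i₁ σ σs′ , consʳ i′

-- (a⟨bs/i⟩)⟨vs/k⟩ ∋ w is obtained as (a⟨vs₁/suc k⟩)⟨bs⟨vs₂/k⟩/i⟩ for some vs = vs₁ ⋈ vs₂
record Commuted (i k : ℕ) (a : RTerm) (bs vs : List RTerm) (w : RTerm) : Set where
  constructor commuted
  field
    {vs₁ vs₂ bs′} : List RTerm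
    {a′}          : RTerm
    split         : Interleaving vs₁ vs₂ vs
    inner         : MSub (suc k) a (renames (punchIn i) vs₁) a′
    arguments     : MSubs k bs vs₂ bs′
    outer         : MSub i a′ bs′ w

record Commutedᴮ (i k : ℕ) (as bs vs ws : List RTerm) : Set where
  constructor commutedᴮ
  field
    {vs₁ vs₂ as′ bs′} : List RTerm
    split             : Interleaving vs₁ vs₂ vs
    inner             : MSubs (suc k) as (renames (punchIn i) vs₁) as′
    arguments         : MSubs k bs vs₂ bs′
    outer             : MSubs i as′ bs′ ws

mutual
  MSub-MSub : ∀ {i k a bs t vs w} → i ≤ k → MSub i a bs t → MSub k t vs w → Commuted i k a bs vs w
  MSub-MSub {i} {k} {vs = vs} i≤k hit σ =
    commuted (allʳ vs)
      (subst (λ x → MSub (suc k) (var i) [] (var x)) (punchOut-< (s≤s i≤k)) (miss λ i≡sk → <-irrefl i≡sk (s≤s i≤k)))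
      (cons (allˡ vs) σ []) hit
  MSub-MSub i≤k (miss n≢i) σ with MSub-var⁻ σ
  ... | inj₁ (eq , v , refl , refl) with punchOut-hit i≤k n≢i eq
  ...   | refl = commuted (consˡ []) hit [] (MSub-punchIn _ v)
  MSub-MSub {i} {k} i≤k (miss {n = n} n≢i) σ | inj₂ (≢k , refl , refl) =
    commuted [] (miss n≢sk) []
      (subst (λ x → MSub i (var (punchOut (suc k) n)) [] (var x)) (punchOut-comm i≤k n≢i n≢sk)
             (miss (punchOut-miss i≤k n≢i n≢sk)))
    where
      n≢sk : n ≢ suc k
      n≢sk n≡sk = ≢k (trans (cong (punchOut i) n≡sk) (punchOut-> (s≤s i≤k)))
  MSub-MSub {i} {k} {bs = bs} {vs = vs} i≤k (lam σ₁) (lam σ₂) with MSub-MSub (s≤s i≤k) σ₁ σ₂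
  ... | commuted split inner arguments outer with interleaving-renames⁻ vs split
  ... | vs₁ , vs₂ , refl , refl , split′ with MSubs-rename⁻ bs vs₂ (Compatible-suc k) arguments
  ... | bs′ , refl , arguments′ =
    commuted split′ (lam (subst (λ x → MSub (suc (suc k)) _ x _) (renames-ext-suc (punchIn i) vs₁) inner))
             arguments′ (lam outer)
  MSub-MSub i≤k (app i₁ σ₁ σs₁) (app i₂ σ₂ σs₂) with MSub-MSub i≤k σ₁ σ₂ | MSubs-MSubs i≤k σs₁ σs₂
  ... | commuted sp inn arg out | commutedᴮ spᴮ innᴮ argᴮ outᴮ with interchange i₂ sp spᴮ
  ... | _ , _ , sp′ , spˡ , spʳ with MSubs-interleaving i₁ arg argᴮ spʳ
  ... | _ , arg′ , i′ = commuted sp′ (app (interleaving-renames⁺ spˡ) inn innᴮ) arg′ (app i′ out outᴮ)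

  MSubs-MSubs : ∀ {i k as bs ts vs ws} → i ≤ k → MSubs i as bs ts → MSubs k ts vs ws → Commutedᴮ i k as bs vs ws
  MSubs-MSubs i≤k [] [] = commutedᴮ [] [] [] []
  MSubs-MSubs i≤k (cons i₁ σ₁ σs₁) (cons i₂ σ₂ σs₂) with MSub-MSub i≤k σ₁ σ₂ | MSubs-MSubs i≤k σs₁ σs₂
  ... | commuted sp inn arg out | commutedᴮ spᴮ innᴮ argᴮ outᴮ with interchange i₂ sp spᴮ
  ... | _ , _ , sp′ , spˡ , spʳ with MSubs-interleaving i₁ arg argᴮ spʳ
  ... | _ , arg′ , i′ = commutedᴮ sp′ (cons (interleaving-renames⁺ spˡ) inn innᴮ) arg′ (cons i′ out outᴮ)

-- Reduction to a summand

infix 4 _↝_ _↝ᴸ_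

_↝_ : RTerm → RTerm → Set
t ↝ t′ = Σ RSum λ T → (t →r T) × t′ ∈ T

↝-lam : ∀ {s s′} → s ↝ s′ → lam s ↝ lam s′
↝-lam (T , d , m) = map lam T , ξλ d , ∈-map⁺ lam m

↝-appˡ : ∀ {s s′ ts} → s ↝ s′ → app s ts ↝ app s′ ts
↝-appˡ {ts = ts} (T , d , m) = _ , ξl d , ∈-map⁺ (λ s′ → app s′ ts) m

↝-appʳ : ∀ {s} us {t t′} vs → t ↝ t′ → app s (us ++ t ∷ vs) ↝ app s (us ++ t′ ∷ vs)
↝-appʳ {s} us vs (T , d , m) = _ , ξr d , ∈-map⁺ (λ t′ → app s (us ++ t′ ∷ vs)) m

→r-rename : ∀ ρ {t t′ T} → t →r T → t′ ∈ T → rename ρ t ↝ rename ρ t′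
→r-rename ρ (β {s} {ts}) m = _ , β , ∈-msub⁺ (MSub-rename (Compatible-ext-0 ρ) (∈-msub⁻ 0 s ts m))
→r-rename ρ (ξλ d) m with ∈-map⁻ lam m
... | _ , m₀ , refl = ↝-lam (→r-rename (ext ρ) d m₀)
→r-rename ρ (ξl {ts = ts} d) m with ∈-map⁻ (λ s′ → app s′ ts) m
... | _ , m₀ , refl = ↝-appˡ (→r-rename ρ d m₀)
→r-rename ρ (ξr {s} {us} {t} {vs} d) m with ∈-map⁻ (λ t′ → app s (us ++ t′ ∷ vs)) m
... | t′ , m₀ , refl =
  subst₂ _↝_ (cong (app (rename ρ s)) (sym (renames-++ ρ us (t ∷ vs))))
             (cong (app (rename ρ s)) (sym (renames-++ ρ us (t′ ∷ vs))))
         (↝-appʳ (renames ρ us) (renames ρ vs) (→r-rename ρ d m₀))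

↝-rename : ∀ ρ {t t′} → t ↝ t′ → rename ρ t ↝ rename ρ t′
↝-rename ρ (_ , d , m) = →r-rename ρ d m

data _↝ᴸ_ : List RTerm → List RTerm → Set where
  here  : ∀ {x y zs} → x ↝ y → x ∷ zs ↝ᴸ y ∷ zs
  there : ∀ {z xs ys} → xs ↝ᴸ ys → z ∷ xs ↝ᴸ z ∷ ys

↝ᴸ-rename : ∀ f {xs ys} → xs ↝ᴸ ys → renames f xs ↝ᴸ renames f ys
↝ᴸ-rename f (here r)  = here (↝-rename f r)
↝ᴸ-rename f (there r) = there (↝ᴸ-rename f r)

↝ᴸ-++ : ∀ us {t t′ vs} → t ↝ t′ → us ++ t ∷ vs ↝ᴸ us ++ t′ ∷ vs
↝ᴸ-++ []       r = here r
↝ᴸ-++ (u ∷ us) r = there (↝ᴸ-++ us r)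

↝ᴸ⇒++ : ∀ {xs ys} → xs ↝ᴸ ys →
        ∃₂ λ us vs → ∃₂ λ t t′ → xs ≡ us ++ t ∷ vs × ys ≡ us ++ t′ ∷ vs × t ↝ t′
↝ᴸ⇒++ (here r) = [] , _ , _ , _ , refl , refl , r
↝ᴸ⇒++ (there {z} rs) with ↝ᴸ⇒++ rs
... | us , vs , _ , _ , refl , refl , r = z ∷ us , vs , _ , _ , refl , refl , r

↝-appᴸ : ∀ {s ts ts′} → ts ↝ᴸ ts′ → app s ts ↝ app s ts′
↝-appᴸ rs with ↝ᴸ⇒++ rs
... | us , vs , _ , _ , refl , refl , r = ↝-appʳ us vs r

interleaving-↝ᴸ : ∀ {vs vs′ l′ r′} → Interleaving l′ r′ vs′ → vs ↝ᴸ vs′ →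
                  (∃ λ l → Interleaving l r′ vs × l ↝ᴸ l′) ⊎ (∃ λ r → Interleaving l′ r vs × r ↝ᴸ r′)
interleaving-↝ᴸ (consˡ i) (here r) = inj₁ (_ , consˡ i , here r)
interleaving-↝ᴸ (consʳ i) (here r) = inj₂ (_ , consʳ i , here r)
interleaving-↝ᴸ (consˡ i) (there rs) with interleaving-↝ᴸ i rs
... | inj₁ (_ , i′ , rs′) = inj₁ (_ , consˡ i′ , there rs′)
... | inj₂ (_ , i′ , rs′) = inj₂ (_ , consˡ i′ , rs′)
interleaving-↝ᴸ (consʳ i) (there rs) with interleaving-↝ᴸ i rs
... | inj₁ (_ , i′ , rs′) = inj₁ (_ , consʳ i′ , rs′)
... | inj₂ (_ , i′ , rs′) = inj₂ (_ , consʳ i′ , there rs′)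

mutual
  MSub-↝-arguments : ∀ {k u vs vs′ w} → MSub k u vs′ w → vs ↝ᴸ vs′ →
                     ∃ λ w′ → MSub k u vs w′ × w′ ↝ w
  MSub-↝-arguments hit (here r) = _ , hit , r
  MSub-↝-arguments (lam σ) rs with MSub-↝-arguments σ (↝ᴸ-rename suc rs)
  ... | _ , σ′ , r = _ , lam σ′ , ↝-lam r
  MSub-↝-arguments (app i σ σs) rs with interleaving-↝ᴸ i rs
  ... | inj₁ (_ , i′ , rs′) with MSub-↝-arguments σ rs′
  ...   | _ , σ′ , r = _ , app i′ σ′ σs , ↝-appˡ r
  MSub-↝-arguments (app i σ σs) rs | inj₂ (_ , i′ , rs′) with MSubs-↝-arguments σs rs′
  ...   | _ , σs′ , rs″ = _ , app i′ σ σs′ , ↝-appᴸ rs″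

  MSubs-↝-arguments : ∀ {k ts vs vs′ ws} → MSubs k ts vs′ ws → vs ↝ᴸ vs′ →
                      ∃ λ ws′ → MSubs k ts vs ws′ × ws′ ↝ᴸ ws
  MSubs-↝-arguments (cons i σ σs) rs with interleaving-↝ᴸ i rs
  ... | inj₁ (_ , i′ , rs′) with MSub-↝-arguments σ rs′
  ...   | _ , σ′ , r = _ , cons i′ σ′ σs , here r
  MSubs-↝-arguments (cons i σ σs) rs | inj₂ (_ , i′ , rs′) with MSubs-↝-arguments σs rs′
  ...   | _ , σs′ , rs″ = _ , cons i′ σ σs′ , there rs″

mutual
  MSub-↝-body : ∀ {k u U u′ vs w} → u →r U → u′ ∈ U → MSub k u′ vs w →
                ∃ λ w′ → MSub k u vs w′ × w′ ↝ w
  MSub-↝-body (β {a} {bs}) m σ with MSub-MSub z≤n (∈-msub⁻ 0 a bs m) σ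
  ... | commuted split inner arguments outer =
    _ , app split (lam inner) arguments , _ , β , ∈-msub⁺ outer
  MSub-↝-body (ξλ d) m σ with ∈-map⁻ lam m
  MSub-↝-body (ξλ d) m (lam σ) | _ , m₀ , refl with MSub-↝-body d m₀ σ
  ... | _ , σ′ , r = _ , lam σ′ , ↝-lam r
  MSub-↝-body (ξl {ts = ts} d) m σ with ∈-map⁻ (λ s′ → app s′ ts) m
  MSub-↝-body (ξl d) m (app i σ σs) | _ , m₀ , refl with MSub-↝-body d m₀ σ
  ... | _ , σ′ , r = _ , app i σ′ σs , ↝-appˡ r
  MSub-↝-body (ξr {s} {us} {t} {vs} d) m σ with ∈-map⁻ (λ t′ → app s (us ++ t′ ∷ vs)) m
  MSub-↝-body (ξr {us = us} d) m (app i σ σs) | _ , m₀ , refl with MSubs-↝-body us d m₀ σs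
  ... | _ , σs′ , rs = _ , app i σ σs′ , ↝-appᴸ rs

  MSubs-↝-body : ∀ {k t T t′ ts r ws} us → t →r T → t′ ∈ T → MSubs k (us ++ t′ ∷ ts) r ws →
                 ∃ λ ws′ → MSubs k (us ++ t ∷ ts) r ws′ × ws′ ↝ᴸ ws
  MSubs-↝-body []       d m (cons i σ σs) with MSub-↝-body d m σ
  ... | _ , σ′ , r = _ , cons i σ′ σs , here r
  MSubs-↝-body (u ∷ us) d m (cons i σ σs) with MSubs-↝-body us d m σs
  ... | _ , σs′ , rs = _ , cons i σ σs′ , there rs

-- RWS t stk : t applied to the monomials of stk is weakly solvable, by the rules of WS
data RWS : RTerm → List (List RTerm) → Set where
  var : ∀ {x stk} → RWS (var x) stk
  app : ∀ {s ts stk} → RWS s (ts ∷ stk) → RWS (app s ts) stk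
  lam : ∀ {s} → RWS s [] → RWS (lam s) []
  β   : ∀ {u vs w stk} → MSub 0 u vs w → RWS w stk → RWS (lam u) (vs ∷ stk)

data _↝ˢ_ : List (List RTerm) → List (List RTerm) → Set where
  here  : ∀ {vs vs′ stk} → vs ↝ᴸ vs′ → (vs ∷ stk) ↝ˢ (vs′ ∷ stk)
  there : ∀ {vs stk stk′} → stk ↝ˢ stk′ → (vs ∷ stk) ↝ˢ (vs ∷ stk′)

mutual
  RWS-↝⁻ : ∀ {s T t stk} → s →r T → t ∈ T → RWS t stk → RWS s stk
  RWS-↝⁻ (β {s} {ts}) m h = app (β (∈-msub⁻ 0 s ts m) h)
  RWS-↝⁻ (ξλ d) m h with ∈-map⁻ lam m
  RWS-↝⁻ (ξλ d) m (lam h)   | _ , m₀ , refl = lam (RWS-↝⁻ d m₀ h)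
  RWS-↝⁻ (ξλ d) m (β σ h)   | _ , m₀ , refl with MSub-↝-body d m₀ σ
  ... | _ , σ′ , (_ , d′ , m′) = β σ′ (RWS-↝⁻ d′ m′ h)
  RWS-↝⁻ (ξl {ts = ts} d) m h with ∈-map⁻ (λ s′ → app s′ ts) m
  RWS-↝⁻ (ξl d) m (app h)   | _ , m₀ , refl = app (RWS-↝⁻ d m₀ h)
  RWS-↝⁻ (ξr {s} {us} {t} {vs} d) m h with ∈-map⁻ (λ t′ → app s (us ++ t′ ∷ vs)) m
  RWS-↝⁻ (ξr {us = us} d) m (app h) | _ , m₀ , refl = app (RWS-↝ˢ⁻ (here (↝ᴸ-++ us (_ , d , m₀))) h)

  RWS-↝ˢ⁻ : ∀ {s stk stk′} → stk ↝ˢ stk′ → RWS s stk′ → RWS s stk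
  RWS-↝ˢ⁻ r         var      = var
  RWS-↝ˢ⁻ r         (app h)  = app (RWS-↝ˢ⁻ (there r) h)
  RWS-↝ˢ⁻ (here rs) (β σ h)  with MSub-↝-arguments σ rs
  ... | _ , σ′ , (_ , d′ , m′) = β σ′ (RWS-↝⁻ d′ m′ h)
  RWS-↝ˢ⁻ (there r) (β σ h)  = β σ (RWS-↝ˢ⁻ r h)

mutual
  Normal⇒RWS : ∀ {t} → Normal t → RWS t []
  Normal⇒RWS var            = var
  Normal⇒RWS (lam n)        = lam (Normal⇒RWS n)
  Normal⇒RWS (app nl n _)   = app (NotLam-Normal⇒RWS nl n)

  NotLam-Normal⇒RWS : ∀ {t stk} → NotLam t → Normal t → RWS t stk
  NotLam-Normal⇒RWS _ var          = var
  NotLam-Normal⇒RWS _ (app nl n _) = app (NotLam-Normal⇒RWS nl n)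

SomeRWS : RSum → Set
SomeRWS T = ∃ λ t → t ∈ T × RWS t []

SomeRWS-⇒r⁻ : ∀ {T T′} → T ⇒r T′ → SomeRWS T′ → SomeRWS T
SomeRWS-⇒r⁻ (step {A} {s} {B} {T} d) (t , m , h) with ∈-++⁻ A m
... | inj₁ mA = t , ∈-++⁺ˡ mA , h
... | inj₂ m′ with ∈-++⁻ T m′
...   | inj₁ mT = s , ∈-++⁺ʳ A (here refl) , RWS-↝⁻ d mT h
...   | inj₂ mB = t , ∈-++⁺ʳ A (there mB) , h

SomeRWS-⇒r*⁻ : ∀ {T S} → T ⇒r* S → SomeRWS S → SomeRWS T
SomeRWS-⇒r*⁻ ε        g = g
SomeRWS-⇒r*⁻ (r ◅ rs) g = SomeRWS-⇒r⁻ r (SomeRWS-⇒r*⁻ rs g)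

IsNF⇒RWS : ∀ {s S} → IsNF s S → S ≢ [] → RWS s []
IsNF⇒RWS {S = []}    _               S≢[] = ⊥-elim (S≢[] refl)
IsNF⇒RWS {S = t ∷ S} (r , (n ∷ _)) _ with SomeRWS-⇒r*⁻ r (t , here refl , Normal⇒RWS n)
... | _ , here refl , h = h

-- Taylor support

module _ {c : Level} {A : Set c} where

  TC-appC : ∀ {M N : Canon A} {s ts} → TC M s → All (TC N) ts → TC (appC M N) (app s ts)
  TC-appC (simp t)  ts = simp (app t ts)
  TC-appC (scal t)  ts = scal (TC-appC t ts)
  TC-appC (plusˡ t) ts = plusˡ (TC-appC t ts)
  TC-appC (plusʳ t) ts = plusʳ (TC-appC t ts)

  TC-lamC : ∀ {M : Canon A} {s} → TC M s → TC (lamC M) (lam s)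
  TC-lamC (simp t)  = simp (lam t)
  TC-lamC (scal t)  = scal (TC-lamC t)
  TC-lamC (plusˡ t) = plusˡ (TC-lamC t)
  TC-lamC (plusʳ t) = plusʳ (TC-lamC t)

  mutual
    TS-renS : ∀ ρ {S : Simple A} {s} → TS S s → TS (renS ρ S) (rename ρ s)
    TS-renS ρ var       = var
    TS-renS ρ (lam t)   = lam (TS-renS (ext ρ) t)
    TS-renS ρ (app t ts) = app (TS-renS ρ t) (All-TC-renC ρ ts)

    TC-renC : ∀ ρ {M : Canon A} {s} → TC M s → TC (renC ρ M) (rename ρ s)
    TC-renC ρ (simp t)  = simp (TS-renS ρ t)
    TC-renC ρ (scal t)  = scal (TC-renC ρ t)
    TC-renC ρ (plusˡ t) = plusˡ (TC-renC ρ t)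
    TC-renC ρ (plusʳ t) = plusʳ (TC-renC ρ t)

    All-TC-renC : ∀ ρ {M : Canon A} {ts} → All (TC M) ts → All (TC (renC ρ M)) (renames ρ ts)
    All-TC-renC ρ []       = []
    All-TC-renC ρ (t ∷ ts) = TC-renC ρ t ∷ All-TC-renC ρ ts

  All-interleaving : ∀ {P : RTerm → Set c} {vs l r} → Interleaving l r vs → All P vs → All P l × All P r
  All-interleaving []        []       = [] , []
  All-interleaving (consˡ i) (p ∷ ps) with All-interleaving i ps
  ... | pl , pr = p ∷ pl , pr
  All-interleaving (consʳ i) (p ∷ ps) with All-interleaving i ps
  ... | pl , pr = pl , p ∷ pr

  -- θ substitutes for k a term whose support contains vs, and renames the other variables as msub does
  Realizes : (ℕ → Canon A) → ℕ → List RTerm → Set c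
  Realizes θ k vs = All (TC (θ k)) vs × (∀ n → n ≢ k → θ n ≡ simp (var (punchOut k n)))

  Realizes-extsC : ∀ {θ k vs} → Realizes θ k vs → Realizes (extsC θ) (suc k) (renames suc vs)
  Realizes-extsC {θ} {k} (ts , others) = All-TC-renC suc ts , others′
    where
      others′ : ∀ n → n ≢ suc k → extsC θ n ≡ simp (var (punchOut (suc k) n))
      others′ zero    _    = refl
      others′ (suc m) m≢k =
        trans (cong (renC suc) (others m (λ m≡k → m≢k (cong suc m≡k))))
              (cong (λ x → simp (var x)) (sym (punchOut-suc k m λ m≡k → m≢k (cong suc m≡k))))

  Realizes-sub0 : ∀ {M : Canon A} {vs} → All (TC M) vs → Realizes (sub0 M) 0 vs
  Realizes-sub0 ts = ts , others
    where
      others : ∀ n → n ≢ 0 → sub0 _ n ≡ simp (var (punchOut 0 n))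
      others zero    0≢0 = ⊥-elim (0≢0 refl)
      others (suc n) _   = refl

  mutual
    TS-subS : ∀ {θ k S s vs w} → TS S s → MSub k s vs w → Realizes θ k vs → TC (subS θ S) w
    TS-subS var σ r with MSub-var⁻ σ
    TS-subS var σ (t ∷ [] , _) | inj₁ (refl , _ , refl , refl) = t
    TS-subS var σ (_ , others) | inj₂ (n≢k , refl , refl) =
      subst (λ M → TC M _) (sym (others _ n≢k)) (simp var)
    TS-subS (lam t) (lam σ) r = TC-lamC (TS-subS t σ (Realizes-extsC r))
    TS-subS (app t ts) (app i σ σs) (vs , others) with All-interleaving i vs
    ... | vsˡ , vsʳ = TC-appC (TS-subS t σ (vsˡ , others)) (All-TC-subC ts σs (vsʳ , others))

    TC-subC : ∀ {θ k M s vs w} → TC M s → MSub k s vs w → Realizes θ k vs → TC (subC θ M) w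
    TC-subC (simp t)  σ r = TS-subS t σ r
    TC-subC (scal t)  σ r = scal (TC-subC t σ r)
    TC-subC (plusˡ t) σ r = plusˡ (TC-subC t σ r)
    TC-subC (plusʳ t) σ r = plusʳ (TC-subC t σ r)

    All-TC-subC : ∀ {θ k M ts vs ws} → All (TC M) ts → MSubs k ts vs ws → Realizes θ k vs → All (TC (subC θ M)) ws
    All-TC-subC []       []            r             = []
    All-TC-subC (t ∷ ts) (cons i σ σs) (vs , others) with All-interleaving i vs
    ... | vsˡ , vsʳ = TC-subC t σ (vsˡ , others) ∷ All-TC-subC ts σs (vsʳ , others)

  appsC-simp : ∀ (S : Simple A) Ms → appsC (simp S) Ms ≡ simp (appsS S Ms)
  appsC-simp S []       = refl
  appsC-simp S (M ∷ Ms) = appsC-simp (app S M) Ms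

  appsC-scal : ∀ a (M : Canon A) Ms → appsC (scal a M) Ms ≡ scal a (appsC M Ms)
  appsC-scal a M []       = refl
  appsC-scal a M (N ∷ Ms) = appsC-scal a (appC M N) Ms

  appsC-plus : ∀ (M N : Canon A) Ms → appsC (plus M N) Ms ≡ plus (appsC M Ms) (appsC N Ms)
  appsC-plus M N []       = refl
  appsC-plus M N (P ∷ Ms) = appsC-plus (appC M P) (appC N P) Ms

  mutual
    RWS⇒WS-TC : ∀ {t stk} {M : Canon A} {Ms} → RWS t stk → TC M t →
                Pointwise (λ N ts → All (TC N) ts) Ms stk → WS (appsC M Ms)
    RWS⇒WS-TC {Ms = Ms} h (simp {S = S} t) args =
      subst WS (sym (appsC-simp S Ms)) (RWS⇒WS-TS h t args)
    RWS⇒WS-TC {Ms = Ms} h (scal {a = a} {M = M} t) args =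
      subst WS (sym (appsC-scal a M Ms)) (ws-scal (RWS⇒WS-TC h t args))
    RWS⇒WS-TC {Ms = Ms} h (plusˡ {M = M} {N = N} t) args =
      subst WS (sym (appsC-plus M N Ms)) (ws-plusˡ (RWS⇒WS-TC h t args))
    RWS⇒WS-TC {Ms = Ms} h (plusʳ {M = M} {N = N} t) args =
      subst WS (sym (appsC-plus M N Ms)) (ws-plusʳ (RWS⇒WS-TC h t args))

    RWS⇒WS-TS : ∀ {t stk} {S : Simple A} {Ms} → RWS t stk → TS S t →
                Pointwise (λ N ts → All (TC N) ts) Ms stk → WS (simp (appsS S Ms))
    RWS⇒WS-TS {Ms = Ms} var     (var {x = x}) args = ws-head x Ms
    RWS⇒WS-TS (app h)   (app t ts) args = RWS⇒WS-TS h t (ts ∷ args)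
    RWS⇒WS-TS (lam h)   (lam t)    []   = ws-lam (RWS⇒WS-TS h t [])
    RWS⇒WS-TS (β σ h)   (lam {S = S} t) (_∷_ {x = M₀} {xs = Ms} ts args) =
      ws-β {S = S} {M0 = M₀} {Ms = Ms} (RWS⇒WS-TC h (TS-subS t σ (Realizes-sub0 ts)) args)

lemma9p3 : ∀ {c ℓ} (R : CommutativeSemiring c ℓ)
             (M : Canon (CommutativeSemiring.Carrier R)) →
             (∃ λ s → TC M s × ∃ λ S → IsNF s S × S ≢ []) →
             WS M
lemma9p3 R M (s , s∈M , S , nf , S≢0) = RWS⇒WS-TC (IsNF⇒RWS nf S≢0) s∈M []
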